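{- Let $\mathscr L$ be a simple affine oriented matroid on a set $E$. Then the reflexive closure of the parallelism relation $\parallel$ is an equivalence relation on $E$.
   Context: Sign vectors on $E$ are maps $X:E\to\{+,-,0\}$, with zero set $z(X)=\{e:X(e)=0\}$, support $\underline X=E\setminus z(X)$, separator $S(X,Y)=\{e\in\underline X\cap\underline Y:X(e)\ne Y(e)\}$, composition $(X\circ Y)(e)=X(e)$ if $X(e)\ne0$ else $Y(e)$, and $(X\oplus Y)(e)=0$ if $e\in S(X,Y)$ else $(X\circ Y)(e)$. For $\mathscr L\subseteq\{+,-,0\}^E$: $I_e(X,Y)=\{Z\in\mathscr L:Z(e)=0,\ Z(f)=(X\circ Y)(f)\ \forall f\notin S(X,Y)\}$, $I(X,Y)=\bigcup_{e\in S(X,Y)}I_e(X,Y)$, $\mathcal P(\mathscr L)=\{X\oplus(-Y):X,Y\in\mathscr L,\ I(X,-Y)=I(-X,Y)=\emptyset\}$. $\mathscr L$ is an affine oriented matroid (AOM) if (FS) $X\circ(-Y)\in\mathscr L$ for $X,Y\in\mathscr L$; (SE) $I_e(X,Y)\ne\emptyset$ for all $X,Y\in\mathscr L$, $e\in S(X,Y)$; (P) $P\circ X\in\mathscr L$ for all $P\in\mathcal P(\mathscr L)$, $X\in\mathscr L$. Two elements $e,f\in E$ are parallel, $e\parallel f$, if there is no $X\in\mathscr L$ with $e,f\in z(X)$. $\mathscr L$ is simple if there is no $e\in E$ with $X(e)=Y(e)$ for all $X,Y\in\mathscr L$, and there are no distinct $e,f\in E$ with $X(e)=X(f)$ for all $X\in\mathscr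 L$ or with $X(e)=-X(f)$ for all $X\in\mathscr L$. -}

module Defs where

open import Data.Nat using (ℕ)
open import Data.Fin using (Fin)
open import Data.Vec using (Vec; lookup; map; zipWith)
open import Data.Product using (Σ; ∃; _×_; _,_)
open import Data.Sum using (_⊎_)
open import Data.Empty using (⊥)
open import Relation.Nullary using (¬_)
open import Relation.Binary.PropositionalEquality using (_≡_; _≢_)

data Sign : Set where
  ⊕s ⊖s 0s : Sign

neg : Sign → Sign
neg ⊕s = ⊖s
neg ⊖s = ⊕s
neg 0s = 0s

-- Sign vectors on the ground set E = Fin n
SignVec : ℕ → Set
SignVec n = Vec Sign n

SignSet : ℕ → Set₁
SignSet n = SignVec n → Set

module _ {n : ℕ} where

  -ᵥ_ : SignVec n → SignVec n
  -ᵥ X = map neg X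

  compS : Sign → Sign → Sign
  compS 0s y = y
  compS ⊕s y = ⊕s
  compS ⊖s y = ⊖s

  _∘ᵥ_ : SignVec n → SignVec n → SignVec n
  X ∘ᵥ Y = zipWith compS X Y

  InSep : SignVec n → SignVec n → Fin n → Set
  InSep X Y e = (lookup X e ≢ 0s) × (lookup Y e ≢ 0s) × (lookup X e ≢ lookup Y e)

  -- (X ⊕ Y)(e): 0 on the separator, (X ∘ Y)(e) elsewhere
  sepS : Sign → Sign → Sign
  sepS ⊕s ⊖s = 0s
  sepS ⊖s ⊕s = 0s
  sepS x y = compS x y

  _⊕ᵥ_ : SignVec n → SignVec n → SignVec n
  X ⊕ᵥ Y = zipWith sepS X Y

  InIe : SignSet n → SignVec n → SignVec n → Fin n → SignVec n → Set
  InIe L X Y e Z = L Z × (lookup Z e ≡ 0s)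
                   × (∀ f → ¬ InSep X Y f → lookup Z f ≡ lookup (X ∘ᵥ Y) f)

  InI : SignSet n → SignVec n → SignVec n → SignVec n → Set
  InI L X Y Z = ∃ λ e → InSep X Y e × InIe L X Y e Z

  IEmpty : SignSet n → SignVec n → SignVec n → Set
  IEmpty L X Y = ∀ Z → ¬ InI L X Y Z

  InP : SignSet n → SignVec n → Set
  InP L P = ∃ λ X → ∃ λ Y → L X × L Y × IEmpty L X (-ᵥ Y) × IEmpty L (-ᵥ X) Y
            × (P ≡ X ⊕ᵥ (-ᵥ Y))

  record IsAOM (L : SignSet n) : Set where
    field
      FS : ∀ X Y → L X → L Y → L (X ∘ᵥ (-ᵥ Y))
      SE : ∀ X Y → L X → L Y → ∀ e → InSep X Y e → ∃ λ Z → InIe L X Y e Z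
      Pax : ∀ P X → InP L P → L X → L (P ∘ᵥ X)

  Parallel : SignSet n → Fin n → Fin n → Set
  Parallel L e f = ¬ (∃ λ X → L X × (lookup X e ≡ 0s) × (lookup X f ≡ 0s))

  ParallelRefl : SignSet n → Fin n → Fin n → Set
  ParallelRefl L e f = (e ≡ f) ⊎ Parallel L e f

  IsSimple : SignSet n → Set
  IsSimple L =
    (¬ (∃ λ e → ∀ X Y → L X → L Y → lookup X e ≡ lookup Y e))
    × (∀ e f → e ≢ f → ¬ (∀ X → L X → lookup X e ≡ lookup X f))
    × (∀ e f → e ≢ f → ¬ (∀ X → L X → lookup X e ≡ neg (lookup X f)))

-- Reflexivity and symmetry are immediate; for transitivity let e ∥ f ∥ g, e ≠ g, and let X₀ vanish
-- at e and g.  If some W vanished at f, all zeros of f would share W's value at e and all zeros of g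
-- would share one value at f.  Take A, B vanishing at g and opposite at e with inclusion-maximal
-- separator: any vector in I(A,-B) or I(-A,B) would yield such a pair with larger separator, so
-- A ⊕ (-B) ∈ 𝒫.  It vanishes at f and equals A at e, so composing it with W forces A(e) = W(e);
-- symmetrically B(e) = W(e), which is absurd.  With X₀ ∘ (-Y) as partner this shows that every zero
-- at g is a zero at e, and then strong elimination at g forces X(e) = τ(X(g)) for all X, with τ the
-- identity or negation, against simplicity.  Hence nothing vanishes at f, so by elimination all
-- vectors agree at f, again against simplicity.
module Submission where

open import Defs
open import Data.Nat using (ℕ)
open import Data.Bool.Properties using (T-≡)
open import Function.Bundles using (Equivalence)
open import Data.Fin using (Fin) renaming (_≟_ to _≟ᶠ_)
open import Data.Fin.Subset using (Subset; _∈_; _⊆_; _⊂_; _⊃_)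
open import Data.Fin.Subset.Properties using (⊆-⊂-trans)
open import Data.Fin.Subset.Induction using (⊃-wellFounded)
open import Data.Vec using (lookup; tabulate)
open import Data.Vec.Properties using (lookup-map; lookup-zipWith; lookup∘tabulate; []=⇒lookup; lookup⇒[]=)
open import Data.Product using (∃; _×_; _,_; proj₁; proj₂; uncurry; map₂)
open import Data.Sum as Sum using (_⊎_; inj₁; inj₂; [_,_]′)
open import Data.Empty using (⊥-elim)
open import Function using (id; _on_)
open import Induction.WellFounded using (WellFounded; Acc; acc)
import Relation.Binary.Construct.On as On
open import Relation.Nullary using (¬_; Dec; yes; no)
open import Relation.Nullary.Decidable using (¬?; _×-dec_; isYes; toWitness; fromWitness)
open import Relation.Binary.PropositionalEquality using (_≡_; _≢_; refl; sym; trans; cong; subst; module ≡-Reasoning)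
open import Relation.Binary.Structures using (IsEquivalence)

infix 4 _≟ₛ_

_≟ₛ_ : (a b : Sign) → Dec (a ≡ b)
⊕s ≟ₛ ⊕s = yes refl
⊕s ≟ₛ ⊖s = no λ ()
⊕s ≟ₛ 0s = no λ ()
⊖s ≟ₛ ⊕s = no λ ()
⊖s ≟ₛ ⊖s = yes refl
⊖s ≟ₛ 0s = no λ ()
0s ≟ₛ ⊕s = no λ ()
0s ≟ₛ ⊖s = no λ ()
0s ≟ₛ 0s = yes refl

neg-involutive : ∀ a → neg (neg a) ≡ a
neg-involutive ⊕s = refl
neg-involutive ⊖s = refl
neg-involutive 0s = refl

neg-≢0s : ∀ {a} → a ≢ 0s → neg a ≢ 0s
neg-≢0s {⊕s} _ ()
neg-≢0s {⊖s} _ ()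
neg-≢0s {0s} a≢0 _ = a≢0 refl

neg-≢ : ∀ {a} → a ≢ 0s → neg a ≢ a
neg-≢ {⊕s} _ ()
neg-≢ {⊖s} _ ()
neg-≢ {0s} a≢0 _ = a≢0 refl

≡neg-sym : ∀ {a b} → a ≡ neg b → b ≡ neg a
≡neg-sym {a} {b} a≡-b = trans (sym (neg-involutive b)) (cong neg (sym a≡-b))

-- InSep X Y k unfolds to Separated (lookup X k) (lookup Y k).
Separated : Sign → Sign → Set
Separated a b = (a ≢ 0s) × (b ≢ 0s) × (a ≢ b)

separated? : (a b : Sign) → Dec (Separated a b)
separated? a b = ¬? (a ≟ₛ 0s) ×-dec ¬? (b ≟ₛ 0s) ×-dec ¬? (a ≟ₛ b)

separated-sym : ∀ {a b} → Separated a b → Separated b a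
separated-sym (a≢0 , b≢0 , a≢b) = b≢0 , a≢0 , λ b≡a → a≢b (sym b≡a)

separated⇒≡neg : ∀ {a b} → Separated a b → a ≡ neg b
separated⇒≡neg {⊕s} {⊖s} _ = refl
separated⇒≡neg {⊖s} {⊕s} _ = refl
separated⇒≡neg {⊕s} {⊕s} (_ , _ , a≢b) = ⊥-elim (a≢b refl)
separated⇒≡neg {⊖s} {⊖s} (_ , _ , a≢b) = ⊥-elim (a≢b refl)
separated⇒≡neg {0s} (a≢0 , _) = ⊥-elim (a≢0 refl)
separated⇒≡neg {⊕s} {0s} (_ , b≢0 , _) = ⊥-elim (b≢0 refl)
separated⇒≡neg {⊖s} {0s} (_ , b≢0 , _) = ⊥-elim (b≢0 refl)

≡⇒¬separated : ∀ {a b} → a ≡ b → ¬ Separated a b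
≡⇒¬separated a≡b (_ , _ , a≢b) = a≢b a≡b

separated-neg : ∀ {a} → a ≢ 0s → Separated a (neg a)
separated-neg a≢0 = a≢0 , neg-≢0s a≢0 , λ a≡-a → neg-≢ a≢0 (sym a≡-a)

≡⊎≡neg : ∀ {a b} → a ≢ 0s → b ≢ 0s → a ≡ b ⊎ a ≡ neg b
≡⊎≡neg {a} {b} a≢0 b≢0 with a ≟ₛ b
... | yes a≡b = inj₁ a≡b
... | no a≢b = inj₂ (separated⇒≡neg (a≢0 , b≢0 , a≢b))

module _ {n : ℕ} where

  -- compS and sepS carry an implicit length they do not depend on.
  private
    infixr 6 _∘ₛ_ _⊕ₛ_
    _∘ₛ_ _⊕ₛ_ : Sign → Sign → Sign
    _∘ₛ_ = compS {n}
    _⊕ₛ_ = sepS {n}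

  ∘ₛ-nonzero : ∀ {a} b → a ≢ 0s → a ∘ₛ b ≡ a
  ∘ₛ-nonzero {⊕s} _ _ = refl
  ∘ₛ-nonzero {⊖s} _ _ = refl
  ∘ₛ-nonzero {0s} _ a≢0 = ⊥-elim (a≢0 refl)

  ∘ₛ-absorb : ∀ a b → (a ∘ₛ b) ∘ₛ b ≡ a ∘ₛ b
  ∘ₛ-absorb ⊕s _ = refl
  ∘ₛ-absorb ⊖s _ = refl
  ∘ₛ-absorb 0s ⊕s = refl
  ∘ₛ-absorb 0s ⊖s = refl
  ∘ₛ-absorb 0s 0s = refl

  ∘ₛ-comm : ∀ a b → ¬ Separated a b → a ∘ₛ b ≡ b ∘ₛ a
  ∘ₛ-comm ⊕s ⊕s _ = refl
  ∘ₛ-comm ⊖s ⊖s _ = refl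
  ∘ₛ-comm 0s 0s _ = refl
  ∘ₛ-comm ⊕s 0s _ = refl
  ∘ₛ-comm ⊖s 0s _ = refl
  ∘ₛ-comm 0s ⊕s _ = refl
  ∘ₛ-comm 0s ⊖s _ = refl
  ∘ₛ-comm ⊕s ⊖s ¬sep = ⊥-elim (¬sep ((λ ()) , (λ ()) , (λ ())))
  ∘ₛ-comm ⊖s ⊕s ¬sep = ⊥-elim (¬sep ((λ ()) , (λ ()) , (λ ())))

  ∘ₛ≡0s⇒≡neg : ∀ a b → a ∘ₛ b ≡ 0s → a ≡ neg b
  ∘ₛ≡0s⇒≡neg 0s 0s _ = refl
  ∘ₛ≡0s⇒≡neg ⊕s _ ()
  ∘ₛ≡0s⇒≡neg ⊖s _ ()
  ∘ₛ≡0s⇒≡neg 0s ⊕s ()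
  ∘ₛ≡0s⇒≡neg 0s ⊖s ()

  ⊕ₛ-neg : ∀ a → a ⊕ₛ neg a ≡ 0s
  ⊕ₛ-neg ⊕s = refl
  ⊕ₛ-neg ⊖s = refl
  ⊕ₛ-neg 0s = refl

  ⊕ₛ-idem : ∀ a → a ⊕ₛ a ≡ a
  ⊕ₛ-idem ⊕s = refl
  ⊕ₛ-idem ⊖s = refl
  ⊕ₛ-idem 0s = refl

  lookup-∘ᵥ : ∀ (X Y : SignVec n) k → lookup (X ∘ᵥ Y) k ≡ lookup X k ∘ₛ lookup Y k
  lookup-∘ᵥ X Y k = lookup-zipWith _∘ₛ_ k X Y

  lookup-⊕ᵥ : ∀ (X Y : SignVec n) k → lookup (X ⊕ᵥ Y) k ≡ lookup X k ⊕ₛ lookup Y k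
  lookup-⊕ᵥ X Y k = lookup-zipWith _⊕ₛ_ k X Y

  lookup--ᵥ : ∀ (X : SignVec n) k → lookup (-ᵥ X) k ≡ neg (lookup X k)
  lookup--ᵥ X k = lookup-map k neg X

  lookup-∘-ᵥ : ∀ (X Y : SignVec n) k → lookup (X ∘ᵥ (-ᵥ Y)) k ≡ lookup X k ∘ₛ neg (lookup Y k)
  lookup-∘-ᵥ X Y k = trans (lookup-∘ᵥ X (-ᵥ Y) k) (cong (lookup X k ∘ₛ_) (lookup--ᵥ Y k))

  InSep--ᵥ : ∀ {X Y : SignVec n} {k} → InSep X (-ᵥ Y) k → Separated (lookup X k) (neg (lookup Y k))
  InSep--ᵥ {X} {Y} {k} = subst (Separated (lookup X k)) (lookup--ᵥ Y k)

  separator : SignVec n → SignVec n → Subset n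
  separator X Y = tabulate λ k → isYes (separated? (lookup X k) (lookup Y k))

  ∈-separator⁺ : ∀ {X Y : SignVec n} {k} → InSep X Y k → k ∈ separator X Y
  ∈-separator⁺ {X} {Y} {k} sep =
    lookup⇒[]= k _ (trans (lookup∘tabulate _ k) (Equivalence.to T-≡ (fromWitness sep)))

  ∈-separator⁻ : ∀ {X Y : SignVec n} {k} → k ∈ separator X Y → InSep X Y k
  ∈-separator⁻ {X} {Y} {k} k∈ =
    toWitness {a? = separated? (lookup X k) (lookup Y k)}
              (Equivalence.from T-≡ (trans (sym (lookup∘tabulate _ k)) ([]=⇒lookup k∈)))

  separator-comm : ∀ X Y → separator X Y ⊆ separator Y X
  separator-comm X Y k∈ = ∈-separator⁺ {Y} {X} (separated-sym (∈-separator⁻ {X} {Y} k∈))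

  separator-growth-wellFounded : WellFounded (_⊃_ on uncurry separator)
  separator-growth-wellFounded = On.wellFounded (uncurry separator) ⊃-wellFounded

  module AOM {L : SignSet n} (aom : IsAOM L) where
    open IsAOM aom

    InIe-sym : ∀ {X Y : SignVec n} {k Z} → InIe L X Y k Z → InIe L Y X k Z
    InIe-sym {X} {Y} {k} {Z} (LZ , Zk , agree) = LZ , Zk , agree′
      where
      agree′ : ∀ j → ¬ InSep Y X j → lookup Z j ≡ lookup (Y ∘ᵥ X) j
      agree′ j ¬sep = begin
        lookup Z j                   ≡⟨ agree j (λ sep → ¬sep (separated-sym sep)) ⟩
        lookup (X ∘ᵥ Y) j            ≡⟨ lookup-∘ᵥ X Y j ⟩
        lookup X j ∘ₛ lookup Y j     ≡⟨ ∘ₛ-comm _ _ (λ sep → ¬sep (separated-sym sep)) ⟩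
        lookup Y j ∘ₛ lookup X j     ≡⟨ sym (lookup-∘ᵥ Y X j) ⟩
        lookup (Y ∘ᵥ X) j            ∎
        where open ≡-Reasoning

    InI-sym : ∀ {X Y Z : SignVec n} → InI L X Y Z → InI L Y X Z
    InI-sym {X} {Y} (k , sep , Z∈Iₖ) = k , separated-sym sep , InIe-sym {X} {Y} Z∈Iₖ

    agree⊎eliminate : ∀ {U V : SignVec n} k → L U → L V → lookup U k ≢ 0s → lookup V k ≢ 0s →
                      lookup U k ≡ lookup V k ⊎ ∃ (InIe L U V k)
    agree⊎eliminate {U} {V} k LU LV Uk≢0 Vk≢0 with lookup U k ≟ₛ lookup V k
    ... | yes Uk≡Vk = inj₁ Uk≡Vk
    ... | no Uk≢Vk = inj₂ (SE U V LU LV k (Uk≢0 , Vk≢0 , Uk≢Vk))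

    Parallel-sym : ∀ {e f} → Parallel L e f → Parallel L f e
    Parallel-sym e∥f (X , LX , Xf , Xe) = e∥f (X , LX , Xe , Xf)

    parallel⇒zeros-agree : ∀ {h k} {U V : SignVec n} → Parallel L h k → L U → L V →
                           lookup U h ≡ 0s → lookup V h ≡ 0s → lookup U k ≡ lookup V k
    parallel⇒zeros-agree {h} {k} {U} {V} h∥k LU LV Uh Vh
      with agree⊎eliminate k LU LV (λ Uk → h∥k (U , LU , Uh , Uk)) (λ Vk → h∥k (V , LV , Vh , Vk))
    ... | inj₁ Uk≡Vk = Uk≡Vk
    ... | inj₂ (Z , LZ , Zk , agree) = ⊥-elim (h∥k (Z , LZ , Zh , Zk))
      where
      Zh : lookup Z h ≡ 0s
      Zh = trans (agree h (λ sep → proj₁ sep Uh))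
                 (trans (lookup-∘ᵥ U V h) (trans (cong (_∘ₛ lookup V h) Uh) Vh))

    nonvanishing⇒constant : ∀ {k} → (∀ W → L W → lookup W k ≢ 0s) →
                            ∀ X Y → L X → L Y → lookup X k ≡ lookup Y k
    nonvanishing⇒constant {k} no-zero X Y LX LY
      with agree⊎eliminate k LX LY (no-zero X LX) (no-zero Y LY)
    ... | inj₁ Xk≡Yk = Xk≡Yk
    ... | inj₂ (Z , LZ , Zk , _) = ⊥-elim (no-zero Z LZ Zk)

    opposite-at-g⇒opposite-at-e : ∀ {e g} → (∀ Z → L Z → lookup Z g ≡ 0s → lookup Z e ≡ 0s) →
                                  ∀ {Y Q} → L Y → L Q → InSep Y Q g → lookup Y e ≡ neg (lookup Q e)
    opposite-at-g⇒opposite-at-e {e} {g} zero-at-g⇒zero-at-e {Y} {Q} LY LQ g-sep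
      with SE Y Q LY LQ g g-sep | separated? (lookup Y e) (lookup Q e)
    ... | _ | yes e-sep = separated⇒≡neg e-sep
    ... | Z , LZ , Zg , agree | no ¬e-sep = ∘ₛ≡0s⇒≡neg _ _ (begin
      lookup Y e ∘ₛ lookup Q e   ≡⟨ sym (lookup-∘ᵥ Y Q e) ⟩
      lookup (Y ∘ᵥ Q) e          ≡⟨ sym (agree e ¬e-sep) ⟩
      lookup Z e                 ≡⟨ zero-at-g⇒zero-at-e Z LZ Zg ⟩
      0s                         ∎)
      where open ≡-Reasoning

    determined-by-g : ∀ {e g} → (∀ Z → L Z → lookup Z g ≡ 0s → lookup Z e ≡ 0s) →
                      ∀ {W M} → L W → L M → lookup W g ≢ 0s →
                      lookup M g ≡ neg (lookup W g) → lookup M e ≡ neg (lookup W e) →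
                      (τ : Sign → Sign) → τ 0s ≡ 0s → (∀ a → τ (neg a) ≡ neg (τ a)) →
                      lookup W e ≡ τ (lookup W g) → ∀ Y → L Y → lookup Y e ≡ τ (lookup Y g)
    determined-by-g {e} {g} zero-at-g⇒zero-at-e {W} {M} LW LM Wg≢0 Mg Me τ τ-0s τ-neg We Y LY
      with lookup Y g ≟ₛ 0s
    ... | yes Yg≡0 = trans (zero-at-g⇒zero-at-e Y LY Yg≡0) (sym (trans (cong τ Yg≡0) τ-0s))
    ... | no Yg≢0 with ≡⊎≡neg Yg≢0 Wg≢0
    ...   | inj₁ Yg≡Wg = begin
      lookup Y e             ≡⟨ opposite-at-g⇒opposite-at-e zero-at-g⇒zero-at-e LY LM Y-sep-M ⟩
      neg (lookup M e)       ≡⟨ cong neg Me ⟩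
      neg (neg (lookup W e)) ≡⟨ neg-involutive _ ⟩
      lookup W e             ≡⟨ We ⟩
      τ (lookup W g)         ≡⟨ cong τ (sym Yg≡Wg) ⟩
      τ (lookup Y g)         ∎
      where
      open ≡-Reasoning
      Y-sep-M : InSep Y M g
      Y-sep-M = subst (Separated (lookup Y g))
                  (sym (trans Mg (cong neg (sym Yg≡Wg)))) (separated-neg Yg≢0)
    ...   | inj₂ Yg≡-Wg = begin
      lookup Y e             ≡⟨ opposite-at-g⇒opposite-at-e zero-at-g⇒zero-at-e LY LW Y-sep-W ⟩
      neg (lookup W e)       ≡⟨ cong neg We ⟩
      neg (τ (lookup W g))   ≡⟨ sym (τ-neg _) ⟩
      τ (neg (lookup W g))   ≡⟨ cong τ (sym Yg≡-Wg) ⟩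
      τ (lookup Y g)         ∎
      where
      open ≡-Reasoning
      Y-sep-W : InSep Y W g
      Y-sep-W = subst (Separated (lookup Y g))
                  (trans (cong neg Yg≡-Wg) (neg-involutive _)) (separated-neg Yg≢0)

    module Straddles {e f g : Fin n} (g∥f : Parallel L g f) (f∥e : Parallel L f e)
                     {W : SignVec n} (LW : L W) (Wf≡0 : lookup W f ≡ 0s) where

      Straddle : SignVec n → SignVec n → Set
      Straddle A B = L A × L B × lookup A g ≡ 0s × lookup B g ≡ 0s
                     × lookup A e ≢ 0s × lookup B e ≡ neg (lookup A e)

      straddle-sym : ∀ {A B} → Straddle A B → Straddle B A
      straddle-sym (LA , LB , Ag , Bg , Ae≢0 , Be) =
        LB , LA , Bg , Ag , (λ Be≡0 → neg-≢0s Ae≢0 (trans (sym Be) Be≡0)) , ≡neg-sym Be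

      straddle-extend : ∀ {A B Z} → Straddle A B → InI L A (-ᵥ B) Z →
                        Straddle (Z ∘ᵥ (-ᵥ B)) B × separator A B ⊂ separator (Z ∘ᵥ (-ᵥ B)) B
      straddle-extend {A} {B} {Z} (_ , LB , Ag , Bg , Ae≢0 , Be) (h , h-sep , LZ , Zh , agree) =
        (FS Z B LZ LB , LB , Z′g , Bg , (λ Z′e≡0 → Ae≢0 (trans (sym Z′e) Z′e≡0)) ,
         trans Be (cong neg (sym Z′e))) ,
        grows , h , ∈-separator⁺ {Z′} {B} h∈ ,
        λ h∈AB → ≡⇒¬separated Ah≡Bh (∈-separator⁻ {A} {B} h∈AB)
        where
        open ≡-Reasoning
        Z′ = Z ∘ᵥ (-ᵥ B)
        off-separator : ∀ k → ¬ Separated (lookup A k) (neg (lookup B k)) →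
                        lookup Z′ k ≡ lookup A k ∘ₛ neg (lookup B k)
        off-separator k ¬sep = begin
          lookup Z′ k                                         ≡⟨ lookup-∘-ᵥ Z B k ⟩
          lookup Z k ∘ₛ neg (lookup B k)                      ≡⟨ cong (_∘ₛ neg (lookup B k)) Zk ⟩
          (lookup A k ∘ₛ neg (lookup B k)) ∘ₛ neg (lookup B k) ≡⟨ ∘ₛ-absorb (lookup A k) _ ⟩
          lookup A k ∘ₛ neg (lookup B k)                      ∎
          where
          Zk : lookup Z k ≡ lookup A k ∘ₛ neg (lookup B k)
          Zk = trans (agree k (λ sep → ¬sep (InSep--ᵥ {A} {B} sep))) (lookup-∘-ᵥ A B k)
        Z′≡A : ∀ {k} → lookup A k ≢ 0s → ¬ Separated (lookup A k) (neg (lookup B k)) →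
               lookup Z′ k ≡ lookup A k
        Z′≡A {k} Ak≢0 ¬sep = trans (off-separator k ¬sep) (∘ₛ-nonzero _ Ak≢0)
        Z′g : lookup Z′ g ≡ 0s
        Z′g = trans (off-separator g (λ sep → proj₁ sep Ag))
                    (trans (cong (_∘ₛ neg (lookup B g)) Ag) (cong neg Bg))
        Z′e : lookup Z′ e ≡ lookup A e
        Z′e = Z′≡A Ae≢0 (≡⇒¬separated (≡neg-sym Be))
        grows : separator A B ⊆ separator Z′ B
        grows {k} k∈ = ∈-separator⁺ {Z′} {B} (subst (λ x → Separated x (lookup B k)) (sym Z′k) sep)
          where
          sep = ∈-separator⁻ {A} {B} k∈
          Z′k = Z′≡A (proj₁ sep) (≡⇒¬separated (separated⇒≡neg sep))
        sepₕ = InSep--ᵥ {A} {B} h-sep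
        Ah≡Bh : lookup A h ≡ lookup B h
        Ah≡Bh = trans (separated⇒≡neg sepₕ) (neg-involutive _)
        h∈ : Separated (lookup Z′ h) (lookup B h)
        h∈ = subst (λ x → Separated x (lookup B h))
                   (sym (trans (lookup-∘-ᵥ Z B h) (cong (_∘ₛ _) Zh)))
               (separated-sym (separated-neg (λ Bh≡0 → proj₁ sepₕ (trans Ah≡Bh Bh≡0))))

      Maximal : SignVec n → SignVec n → Set
      Maximal A B = ∀ {C D} → ¬ (Straddle C D × separator A B ⊂ separator C D)

      maximal-straddle⇒InP : ∀ {A B} → Straddle A B → Maximal A B → InP L (A ⊕ᵥ (-ᵥ B))
      maximal-straddle⇒InP {A} {B} st@(LA , LB , _) maximal = A , B , LA , LB , I₁ , I₂ , refl
        where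
        I₁ : IEmpty L A (-ᵥ B)
        I₁ Z Z∈I = maximal (straddle-extend st Z∈I)
        I₂ : IEmpty L (-ᵥ A) B
        I₂ Z Z∈I = maximal (map₂ (⊆-⊂-trans (separator-comm A B))
                                 (straddle-extend (straddle-sym st) (InI-sym { -ᵥ A} {B} Z∈I)))

      InP-vanishing-at-f⇒agrees-with-W : ∀ {P} → InP L P → lookup P f ≡ 0s → lookup P e ≢ 0s →
                                         lookup P e ≡ lookup W e
      InP-vanishing-at-f⇒agrees-with-W {P} P∈𝒫 Pf≡0 Pe≢0 = begin
        lookup P e                 ≡⟨ sym (∘ₛ-nonzero _ Pe≢0) ⟩
        lookup P e ∘ₛ lookup W e   ≡⟨ sym (lookup-∘ᵥ P W e) ⟩
        lookup (P ∘ᵥ W) e          ≡⟨ parallel⇒zeros-agree f∥e (Pax P W P∈𝒫 LW) LW PWf≡0 Wf≡0 ⟩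
        lookup W e                 ∎
        where
        open ≡-Reasoning
        PWf≡0 : lookup (P ∘ᵥ W) f ≡ 0s
        PWf≡0 = trans (lookup-∘ᵥ P W f) (trans (cong (_∘ₛ lookup W f) Pf≡0) Wf≡0)

      maximal-straddle⇒agrees-with-W : ∀ {A B} → Straddle A B → Maximal A B → lookup A e ≡ lookup W e
      maximal-straddle⇒agrees-with-W {A} {B} st@(LA , LB , Ag , Bg , Ae≢0 , Be) maximal =
        trans (sym Pe≡Ae) (InP-vanishing-at-f⇒agrees-with-W (maximal-straddle⇒InP st maximal) Pf≡0
                             (λ Pe≡0 → Ae≢0 (trans (sym Pe≡Ae) Pe≡0)))
        where
        open ≡-Reasoning
        Af≡Bf : lookup A f ≡ lookup B f
        Af≡Bf = parallel⇒zeros-agree g∥f LA LB Ag Bg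
        Pf≡0 : lookup (A ⊕ᵥ (-ᵥ B)) f ≡ 0s
        Pf≡0 = begin
          lookup (A ⊕ᵥ (-ᵥ B)) f           ≡⟨ lookup-⊕ᵥ A (-ᵥ B) f ⟩
          lookup A f ⊕ₛ lookup (-ᵥ B) f    ≡⟨ cong (lookup A f ⊕ₛ_) (lookup--ᵥ B f) ⟩
          lookup A f ⊕ₛ neg (lookup B f)   ≡⟨ cong (λ x → lookup A f ⊕ₛ neg x) (sym Af≡Bf) ⟩
          lookup A f ⊕ₛ neg (lookup A f)   ≡⟨ ⊕ₛ-neg (lookup A f) ⟩
          0s                               ∎
        Pe≡Ae : lookup (A ⊕ᵥ (-ᵥ B)) e ≡ lookup A e
        Pe≡Ae = begin
          lookup (A ⊕ᵥ (-ᵥ B)) e           ≡⟨ lookup-⊕ᵥ A (-ᵥ B) e ⟩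
          lookup A e ⊕ₛ lookup (-ᵥ B) e    ≡⟨ cong (lookup A e ⊕ₛ_) (lookup--ᵥ B e) ⟩
          lookup A e ⊕ₛ neg (lookup B e)   ≡⟨ cong (lookup A e ⊕ₛ_) (sym (≡neg-sym Be)) ⟩
          lookup A e ⊕ₛ lookup A e         ≡⟨ ⊕ₛ-idem (lookup A e) ⟩
          lookup A e                       ∎

      no-straddle : ∀ {A B} → Acc (_⊃_ on uncurry separator) (A , B) → ¬ Straddle A B
      no-straddle {A} {B} (acc rs) st@(_ , _ , _ , _ , Ae≢0 , Be) = neg-≢ Ae≢0 (begin
        neg (lookup A e) ≡⟨ sym Be ⟩
        lookup B e       ≡⟨ maximal-straddle⇒agrees-with-W (straddle-sym st) maximalBA ⟩
        lookup W e       ≡⟨ sym (maximal-straddle⇒agrees-with-W st maximalAB) ⟩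
        lookup A e       ∎)
        where
        open ≡-Reasoning
        maximalAB : Maximal A B
        maximalAB {C} {D} (st′ , grows) = no-straddle (rs {C , D} grows) st′
        maximalBA : Maximal B A
        maximalBA (st′ , grows) = maximalAB (st′ , ⊆-⊂-trans (separator-comm A B) grows)

      vanishing-at-g⇒vanishing-at-e : ∀ {X₀} → L X₀ → lookup X₀ e ≡ 0s → lookup X₀ g ≡ 0s →
                                      ∀ Y → L Y → lookup Y g ≡ 0s → lookup Y e ≡ 0s
      vanishing-at-g⇒vanishing-at-e {X₀} LX₀ X₀e X₀g Y LY Yg with lookup Y e ≟ₛ 0s
      ... | yes Ye≡0 = Ye≡0
      ... | no Ye≢0 = ⊥-elim (no-straddle (separator-growth-wellFounded (Y , M))
                                          (LY , FS X₀ Y LX₀ LY , Yg , Mg , Ye≢0 , Me))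
        where
        M = X₀ ∘ᵥ (-ᵥ Y)
        Mg : lookup M g ≡ 0s
        Mg = trans (lookup-∘-ᵥ X₀ Y g) (trans (cong (_∘ₛ neg (lookup Y g)) X₀g) (cong neg Yg))
        Me : lookup M e ≡ neg (lookup Y e)
        Me = trans (lookup-∘-ᵥ X₀ Y e) (cong (_∘ₛ neg (lookup Y e)) X₀e)

    module _ (simple : IsSimple L) where

      nothing-vanishes-between : ∀ {e f g} → Parallel L e f → Parallel L f g → e ≢ g →
                                 ∀ {X₀} → L X₀ → lookup X₀ e ≡ 0s → lookup X₀ g ≡ 0s →
                                 ∀ W → L W → lookup W f ≢ 0s
      nothing-vanishes-between {e} {f} {g} e∥f f∥g e≢g {X₀} LX₀ X₀e X₀g W LW Wf≡0 =
        [ (λ We≡Wg → proj₁ (proj₂ simple) e g e≢g (determined id refl (λ _ → refl) We≡Wg))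
        , (λ We≡-Wg → proj₂ (proj₂ simple) e g e≢g (determined neg refl (λ _ → refl) We≡-Wg))
        ]′ (≡⊎≡neg We≢0 Wg≢0)
        where
        open Straddles (Parallel-sym f∥g) (Parallel-sym e∥f) LW Wf≡0
        We≢0 : lookup W e ≢ 0s
        We≢0 We≡0 = e∥f (W , LW , We≡0 , Wf≡0)
        Wg≢0 : lookup W g ≢ 0s
        Wg≢0 Wg≡0 = f∥g (W , LW , Wf≡0 , Wg≡0)
        determined : (τ : Sign → Sign) → τ 0s ≡ 0s → (∀ a → τ (neg a) ≡ neg (τ a)) →
                     lookup W e ≡ τ (lookup W g) → ∀ Y → L Y → lookup Y e ≡ τ (lookup Y g)
        determined = determined-by-g (vanishing-at-g⇒vanishing-at-e LX₀ X₀e X₀g)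
                       LW (FS X₀ W LX₀ LW) Wg≢0
                       (trans (lookup-∘-ᵥ X₀ W g) (cong (_∘ₛ neg (lookup W g)) X₀g))
                       (trans (lookup-∘-ᵥ X₀ W e) (cong (_∘ₛ neg (lookup W e)) X₀e))

      Parallel-trans : ∀ {e f g} → Parallel L e f → Parallel L f g → e ≢ g → Parallel L e g
      Parallel-trans {f = f} e∥f f∥g e≢g (X₀ , LX₀ , X₀e , X₀g) =
        proj₁ simple (f , nonvanishing⇒constant (nothing-vanishes-between e∥f f∥g e≢g LX₀ X₀e X₀g))

      ParallelRefl-trans : ∀ {e f g} → ParallelRefl L e f → ParallelRefl L f g → ParallelRefl L e g
      ParallelRefl-trans (inj₁ refl) f≈g = f≈g
      ParallelRefl-trans (inj₂ e∥f) (inj₁ refl) = inj₂ e∥f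
      ParallelRefl-trans {e} {_} {g} (inj₂ e∥f) (inj₂ f∥g) with e ≟ᶠ g
      ... | yes e≡g = inj₁ e≡g
      ... | no e≢g = inj₂ (Parallel-trans e∥f f∥g e≢g)

corollary2p22 : (n : ℕ) (L : SignSet n) → IsAOM L → IsSimple L
    → IsEquivalence (ParallelRefl L)
corollary2p22 n L aom simple = record
  { refl  = inj₁ refl
  ; sym   = Sum.map sym Parallel-sym
  ; trans = ParallelRefl-trans simple
  }
  where open AOM aom
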